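{- $w(\mathsf{T_f}(2))\ge\omega+1$.
   Context: $2$ is the two-element chain $0<1$. $\mathsf{T_f}(2)$: smallest class containing leaves $\cdot0,\cdot1$ and, for every finite non-empty set $\{\tau_0,\dots,\tau_{k-1}\}$ of its members, the tree $\cdot(\tau_0,\dots,\tau_{k-1})$; ordered by $\le_T$: $\cdot x\le_T\cdot y$ iff $x\le y$; $\cdot x\le_T\cdot(\tau_0,\dots,\tau_{l-1})$ iff $\cdot x\le_T\tau_j$ for some $j$; $\cdot(\sigma_0,\dots,\sigma_{k-1})\le_T\cdot(\tau_0,\dots,\tau_{l-1})$ iff each $\sigma_i\le_T$ some $\tau_j$; an internal tree is never $\le_T$ a leaf. The width of a well-quasi-order is $w(P)=\sup_{x\in P}(w(L_\perp(x))+1)$, where $L_\perp(x)$ is the induced suborder of elements incomparable to $x$, and $w(\emptyset)=0$. -}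

module Defs where

open import Data.Nat using (ℕ; zero; suc)
open import Data.List.NonEmpty using (List⁺; toList)
open import Data.List.Relation.Unary.Any using (Any)
open import Data.List.Relation.Unary.All using (All)
open import Data.Product using (Σ; _×_)
open import Data.Unit using (⊤)
open import Relation.Nullary using (¬_)

data Two : Set where
  𝟎 𝟏 : Two

data _≤₂_ : Two → Two → Set where
  0≤0 : 𝟎 ≤₂ 𝟎
  0≤1 : 𝟎 ≤₂ 𝟏
  1≤1 : 𝟏 ≤₂ 𝟏

-- T_f(2): leaves ·x and internal nodes ·(τ₀,…,τ_{k-1}) over a finite
-- non-empty collection of trees (represented by a non-empty list; the
-- order below only depends on membership, so list representations of the
-- same set are ≤_T-equivalent).
data Tree : Set where
  leaf : Two → Tree
  node : List⁺ Tree → Tree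

data _≤T_ : Tree → Tree → Set where
  leaf≤leaf : ∀ {x y} → x ≤₂ y → leaf x ≤T leaf y
  leaf≤node : ∀ {x ts} → Any (leaf x ≤T_) (toList ts) → leaf x ≤T node ts
  node≤node : ∀ {ss ts} → All (λ s → Any (s ≤T_) (toList ts)) (toList ss)
            → node ss ≤T node ts

_⊥T_ : Tree → Tree → Set
x ⊥T y = ¬ (x ≤T y) × ¬ (y ≤T x)

Sub : Set₁
Sub = Tree → Set

L⊥ : Sub → Tree → Sub
L⊥ P x y = P y × (x ⊥T y)

data Ord : Set where
  oz : Ord
  os : Ord → Ord
  olim : (ℕ → Ord) → Ord

fin : ℕ → Ord
fin zero = oz
fin (suc n) = os (fin n)

ω : Ord
ω = olim fin

-- α ≤w P  means  α ≤ w(P), where w(P) = sup_{x∈P} (w(L⊥(x)) + 1).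
-- Unfolded by recursion on α:
--   0 ≤ w(P) always;
--   α+1 ≤ w(P)  iff  some x ∈ P has α ≤ w(L⊥(x))   (sup of successors);
--   sup_n α_n ≤ w(P)  iff  every α_n ≤ w(P).
_≤w_ : Ord → Sub → Set
oz ≤w P = ⊤
os α ≤w P = Σ Tree (λ x → P x × (α ≤w L⊥ P x))
olim f ≤w P = ∀ n → f n ≤w P

Tf2 : Sub
Tf2 _ = ⊤

{-# OPTIONS --safe #-}
module Submission where

-- The witness is ···1 = stick 𝟏 3. Every fork ·(·(1, ·ᵃ0), ·ᵇ0) with b ≥ 3 is incomparable to it,
-- and one fork embeds in another only if a ≤ c and b ≤ max(c + 1, d). Taking a
-- increasing and b decreasing but always large therefore yields antichains of every
-- finite size inside L⊥(···1), so w(L⊥(···1)) ≥ ω.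

open import Defs
open import Data.Nat using (ℕ; zero; suc; _+_; _∸_; _≤_; _<_; z≤n; s≤s)
open import Data.Nat.Properties
  using (≤-refl; ≤-trans; ≤-antisym; <-irrefl; <⇒≱; <⇒≤; m≤m+n; m≤n+m; m<n⇒m<1+n; +-cancelˡ-≤; ∸-cancelʳ-≤)
open import Data.List using ([]; _∷_)
open import Data.List.NonEmpty using () renaming (_∷_ to _∷⁺_)
open import Data.List.Relation.Unary.Any using (here; there)
open import Data.List.Relation.Unary.All using ([]; _∷_)
open import Data.Product using (_×_; _,_)
open import Data.Sum using (_⊎_; inj₁; inj₂)
open import Data.Unit using (tt)
open import Data.Empty using (⊥-elim)
open import Relation.Nullary using (¬_)
open import Relation.Binary.PropositionalEquality using (_≡_; sym)

antichain⇒fin≤w : (P : Sub) (a : ℕ → Tree) (k : ℕ) →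
                  (∀ {i} → i < k → P (a i)) →
                  (∀ {i j} → i < k → j < k → a i ≤T a j → i ≡ j) →
                  fin k ≤w P
antichain⇒fin≤w P a zero _ _ = tt
antichain⇒fin≤w P a (suc k) inP antichain =
  a k , inP ≤-refl ,
  antichain⇒fin≤w (L⊥ P (a k)) a k
    (λ i<k → inP (m<n⇒m<1+n i<k) , incomparable i<k)
    (λ i<k j<k → antichain (m<n⇒m<1+n i<k) (m<n⇒m<1+n j<k))
  where
  incomparable : ∀ {i} → i < k → a k ⊥T a i
  incomparable i<k =
      (λ k≤i → <-irrefl (sym (antichain ≤-refl (m<n⇒m<1+n i<k) k≤i)) i<k)
    , (λ i≤k → <-irrefl (antichain (m<n⇒m<1+n i<k) ≤-refl i≤k) i<k)

stick : Two → ℕ → Tree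
stick x zero = leaf x
stick x (suc d) = node (stick x d ∷⁺ [])

stick-≤T⁻¹ : ∀ {x y} a b → stick x a ≤T stick y b → a ≤ b
stick-≤T⁻¹ zero    b       _ = z≤n
stick-≤T⁻¹ (suc a) (suc b) (node≤node (here p ∷ [])) = s≤s (stick-≤T⁻¹ a b p)

stick𝟏≰stick𝟎 : ∀ a b → ¬ stick 𝟏 a ≤T stick 𝟎 b
stick𝟏≰stick𝟎 zero    zero    (leaf≤leaf ())
stick𝟏≰stick𝟎 zero    (suc b) (leaf≤node (here p)) = stick𝟏≰stick𝟎 zero b p
stick𝟏≰stick𝟎 (suc a) (suc b) (node≤node (here p ∷ [])) = stick𝟏≰stick𝟎 a b p

flag : ℕ → Tree
flag a = node (leaf 𝟏 ∷⁺ stick 𝟎 a ∷ [])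

fork : ℕ → ℕ → Tree
fork a b = node (flag a ∷⁺ stick 𝟎 b ∷ [])

flag≰stick𝟎 : ∀ a b → ¬ flag a ≤T stick 𝟎 b
flag≰stick𝟎 a (suc b) (node≤node (here p ∷ _)) = stick𝟏≰stick𝟎 zero b p

flag-≤T⁻¹ : ∀ a c → flag a ≤T flag c → a ≤ c
flag-≤T⁻¹ a c (node≤node (_ ∷ here p ∷ []))         = ≤-trans (stick-≤T⁻¹ a zero p) z≤n
flag-≤T⁻¹ a c (node≤node (_ ∷ there (here p) ∷ [])) = stick-≤T⁻¹ a c p

stick𝟎-≤T-flag⁻¹ : ∀ b c → stick 𝟎 b ≤T flag c → b ≤ suc c
stick𝟎-≤T-flag⁻¹ zero    c _                                  = z≤n
stick𝟎-≤T-flag⁻¹ (suc b) c (node≤node (here p ∷ []))         = s≤s (≤-trans (stick-≤T⁻¹ b zero p) z≤n)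
stick𝟎-≤T-flag⁻¹ (suc b) c (node≤node (there (here p) ∷ [])) = s≤s (stick-≤T⁻¹ b c p)

fork-≤T⁻¹ : ∀ a b c d → fork a b ≤T fork c d → a ≤ c × (b ≤ suc c ⊎ b ≤ d)
fork-≤T⁻¹ a b c d (node≤node (here p ∷ here q ∷ []))         = flag-≤T⁻¹ a c p , inj₁ (stick𝟎-≤T-flag⁻¹ b c q)
fork-≤T⁻¹ a b c d (node≤node (here p ∷ there (here q) ∷ [])) = flag-≤T⁻¹ a c p , inj₂ (stick-≤T⁻¹ b d q)
fork-≤T⁻¹ a b c d (node≤node (there (here p) ∷ _))           = ⊥-elim (flag≰stick𝟎 a d p)

stick𝟏3⊥fork : ∀ a b → 3 ≤ b → stick 𝟏 3 ⊥T fork a b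
stick𝟏3⊥fork a b 3≤b = stick𝟏3≰fork , fork≰stick𝟏3
  where
  stick𝟏3≰fork : ¬ stick 𝟏 3 ≤T fork a b
  stick𝟏3≰fork (node≤node (here (node≤node (here () ∷ [])) ∷ []))
  stick𝟏3≰fork (node≤node (here (node≤node (there (here p) ∷ [])) ∷ [])) = stick𝟏≰stick𝟎 1 a p
  stick𝟏3≰fork (node≤node (there (here p) ∷ []))                         = stick𝟏≰stick𝟎 2 b p

  fork≰stick𝟏3 : ¬ fork a b ≤T stick 𝟏 3
  fork≰stick𝟏3 (node≤node (_ ∷ here p ∷ [])) = <⇒≱ 3≤b (stick-≤T⁻¹ b 2 p)

-- The second coordinate is at least 3 (keeping the fork incomparable to ···1), exceeds n
-- (ruling out b ≤ c + 1 in fork-≤T⁻¹) and decreases in i.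
forks : ℕ → ℕ → Tree
forks n i = fork i (3 + n + (n ∸ i))

forks-antichain : ∀ n {i j} → i < n → j < n → forks n i ≤T forks n j → i ≡ j
forks-antichain n {i} {j} i<n j<n le with fork-≤T⁻¹ _ _ _ _ le
... | _   , inj₁ b≤1+j = ⊥-elim (<⇒≱ 1+j<b b≤1+j)
  where
  1+j<b : suc j < 3 + n + (n ∸ i)
  1+j<b = ≤-trans (s≤s j<n) (≤-trans (m≤n+m (suc n) 2) (m≤m+n (3 + n) (n ∸ i)))
... | i≤j , inj₂ b≤b′ =
  ≤-antisym i≤j (∸-cancelʳ-≤ (<⇒≤ j<n) (+-cancelˡ-≤ (3 + n) (n ∸ i) (n ∸ j) b≤b′))

lemma3p22 : os ω ≤w Tf2
lemma3p22 = stick 𝟏 3 , tt , λ n →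
  antichain⇒fin≤w (L⊥ Tf2 (stick 𝟏 3)) (forks n) n
    (λ {i} _ → tt , stick𝟏3⊥fork i _ (≤-trans (m≤m+n 3 n) (m≤m+n (3 + n) (n ∸ i))))
    (forks-antichain n)
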